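{- Let $\dot G\in\mathcal C_1\cup\mathcal C_4\cup\mathcal C_5$ be a connected, non-complete, $6$-regular and $2$ net-regular strongly regular signed graph with parameters $(n,6,a,b,c)$. If $\dot G$ contains an unbalanced triangle of the first type, then $(a,b)\notin\{(-2,-1),(-2,0),(-2,1)\}$.
   Context: Signed graphs. - A signed graph $\dot G=(G,\sigma)$ is a simple graph $G$ (the underlying graph) with a sign function $\sigma:E(G)\to\{\pm1\}$. - The adjacency matrix has entries $\sigma(v_iv_j)$ for adjacent pairs and $0$ otherwise. - Connected, complete and regular refer to $G$. - $\dot G$ is $\rho$ net-regular if every vertex has (number of positive incident edges) $-$ (number of negative incident edges) $=\rho$. - $\dot G$ is homogeneous if all edges have the same sign. Triangles. - A triangle is unbalanced if the product of its edge signs is $-1$. - An unbalanced triangle is of the first type if exactly one of its edges is negative, and of the second type if all three edges are negative. Strongly regular signed graphs. - An SRSG is a signed graph on $n$ vertices, neither homogeneous complete nor edgeless, for which there are $r\in\mathbb N$ and $a,b,c\in\mathbb Z$ such that the entries of $A(\dot G)^2$ are: - $r$ on the diagonal; - $a$ for pairs joined by a positive edge; - $b$ for pairs joined by a negative edge; - $c$ for distinct non-adjacent pairs. - $(n,r,a,b,c)$ are its parameters. Classes of inhomogeneous SRSGs. - $\mathcal C_1$: $a=-b$, and either complete, or non-complete with $c\ne0$. - $\mathcal C_4$: $a\ne-b$, non-complete, $c=0$. - $\mathcal C_5$: $a\ne-b$, non-complete, $c\ne\frac{a+b}2$ and $c\neq0$. -}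

module Defs where

open import Data.Nat using (ℕ; zero; suc)
open import Data.Integer using (ℤ; +_; -_; _+_; _*_; ∣_∣)
open import Data.Fin using (Fin; zero; suc)
open import Data.Product using (Σ; _×_; ∃; ∃-syntax)
open import Data.Sum using (_⊎_)
open import Relation.Binary.PropositionalEquality using (_≡_; _≢_)
open import Relation.Nullary using (¬_)

Σℤ : (n : ℕ) → (Fin n → ℤ) → ℤ
Σℤ zero    f = + 0
Σℤ (suc n) f = f zero + Σℤ n (λ i → f (suc i))

record SignedGraph (n : ℕ) : Set where
  field
    A     : Fin n → Fin n → ℤ
    entry : ∀ i j → A i j ≡ + 0 ⊎ A i j ≡ + 1 ⊎ A i j ≡ - (+ 1)
    symm  : ∀ i j → A i j ≡ A j i
    loopless : ∀ i → A i i ≡ + 0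
open SignedGraph public

module _ {n : ℕ} (G : SignedGraph n) where

  Adjacent : Fin n → Fin n → Set
  Adjacent i j = A G i j ≢ + 0

  PosEdge : Fin n → Fin n → Set
  PosEdge i j = A G i j ≡ + 1

  NegEdge : Fin n → Fin n → Set
  NegEdge i j = A G i j ≡ - (+ 1)

  A² : Fin n → Fin n → ℤ
  A² i j = Σℤ n (λ k → A G i k * A G k j)

  degree : Fin n → ℕ
  degree i = ∣ Σℤ n (λ k → + ∣ A G i k ∣) ∣

  netDegree : Fin n → ℤ
  netDegree i = Σℤ n (λ k → A G i k)

  Regular : ℕ → Set
  Regular r = ∀ i → degree i ≡ r

  NetRegular : ℤ → Set
  NetRegular ρ = ∀ i → netDegree i ≡ ρ

  data Walk : Fin n → Fin n → Set where
    here : ∀ {i} → Walk i i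
    step : ∀ {i j k} → Adjacent i j → Walk j k → Walk i k

  Connected : Set
  Connected = ∀ i j → Walk i j

  Complete : Set
  Complete = ∀ i j → i ≢ j → Adjacent i j

  Edgeless : Set
  Edgeless = ∀ i j → A G i j ≡ + 0

  Homogeneous : Set
  Homogeneous = (∀ i j → A G i j ≢ - (+ 1)) ⊎ (∀ i j → A G i j ≢ + 1)

  record IsSRSG (r : ℕ) (a b c : ℤ) : Set where
    field
      notHomComplete : ¬ (Homogeneous × Complete)
      notEdgeless    : ¬ Edgeless
      diag   : ∀ i → A² i i ≡ + r
      posAdj : ∀ i j → PosEdge i j → A² i j ≡ a
      negAdj : ∀ i j → NegEdge i j → A² i j ≡ b
      nonAdj : ∀ i j → i ≢ j → A G i j ≡ + 0 → A² i j ≡ c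

  InC₁ : ℤ → ℤ → ℤ → Set
  InC₁ a b c = ¬ Homogeneous × a ≡ - b × (Complete ⊎ (¬ Complete × c ≢ + 0))

  InC₄ : ℤ → ℤ → ℤ → Set
  InC₄ a b c = ¬ Homogeneous × a ≢ - b × ¬ Complete × c ≡ + 0

  -- c ≠ (a+b)/2 is written as 2c ≠ a + b
  InC₅ : ℤ → ℤ → ℤ → Set
  InC₅ a b c = ¬ Homogeneous × a ≢ - b × ¬ Complete × (+ 2 * c ≢ a + b) × c ≢ + 0

  UnbalancedTriangleFirstType : Set
  UnbalancedTriangleFirstType =
    ∃[ i ] ∃[ j ] ∃[ k ] (i ≢ j × j ≢ k × i ≢ k ×
      ((NegEdge i j × PosEdge j k × PosEdge i k)
       ⊎ (PosEdge i j × NegEdge j k × PosEdge i k)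
       ⊎ (PosEdge i j × PosEdge j k × NegEdge i k)))

-- Every vertex has four positive and two negative neighbours.  Weighting each closed walk
-- i-j-k-i by (2[σij = 1] + 4[σij = -1]) σjk σki + 6 [σij = σki = -1, σjk = 1] gives a sum
-- that is nonnegative over the three rotations of any triangle; evaluating the weighted
-- walks through A² shows 0 ≤ 4a + 4b + 6, so b ≥ 1 when a = -2.  For (a, b) = (-2, 1),
-- summing a row of A² gives c (n - 7) = 4, hence n ∈ {8, 9, 11}.  Since tr A³ counts every
-- triangle once per rotation, 3 divides tr A³ = -10 n, which excludes n = 8 and n = 11.
-- For n = 9 two non-adjacent vertices have 5 or 6 common neighbours, and A² + (number of
-- common neighbours) is even, so they have all 6 in common; then adjacent vertices have
-- 2 · 6 - 9 = 3 common neighbours, and parity fails on a positive edge.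

module Submission where

open import Defs
open import Data.Nat as ℕ using (ℕ; zero; suc)
import Data.Nat.Divisibility as ℕ
open import Data.Integer as ℤ using (ℤ; +_; -_; -[1+_]; 0ℤ; 1ℤ; -1ℤ; _+_; _*_; _-_; _≤_; ∣_∣; _≤?_; _≟_)
import Data.Integer.Properties as ℤ
open import Data.Integer.Divisibility.Signed
  using (_∣_; _∣?_; divides; ∣-refl; ∣m∣n⇒∣m+n; ∣m⇒∣m*n; ∣⇒∣ᵤ)
open import Data.Integer.Tactic.RingSolver using (solve-∀)
open import Data.Fin as Fin using (Fin; zero; suc)
open import Data.Fin.Properties using (all?; suc-injective; nonZeroIndex)
open import Data.Empty using (⊥-elim)
open import Data.Sum using (_⊎_; inj₁; inj₂)
open import Data.Product using (_×_; _,_; ∃₂)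
open import Function using (_∘_)
open import Relation.Binary.PropositionalEquality
open import Relation.Nullary using (¬_; Dec; yes; no; contradiction)
open import Relation.Nullary.Decidable using (True; toWitness; from-no; _→-dec_)
open import Algebra.Properties.Semiring.Sum ℤ.+-*-semiring
  using (sum; ∑-distrib-+; ∑-comm; sum-cong-≗; *-distribˡ-sum; *-distribʳ-sum; sum-replicate-zero)

-- Finite sums

Σℤ≡sum : ∀ n (f : Fin n → ℤ) → Σℤ n f ≡ sum f
Σℤ≡sum zero    f = refl
Σℤ≡sum (suc n) f = cong (λ s → f zero + s) (Σℤ≡sum n (f ∘ suc))

sum-const : ∀ n (x : ℤ) → sum {n} (λ _ → x) ≡ + n * x
sum-const zero    x = sym (ℤ.*-zeroˡ x)
sum-const (suc n) x = trans (cong (λ s → x + s) (sum-const n x)) (distrib x (+ n))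
  where distrib : ∀ x m → x + m * x ≡ (1ℤ + m) * x
        distrib = solve-∀

sum-mono-≤ : ∀ {n} {f g : Fin n → ℤ} → (∀ i → f i ≤ g i) → sum f ≤ sum g
sum-mono-≤ {zero}  f≤g = ℤ.≤-refl
sum-mono-≤ {suc n} f≤g = ℤ.+-mono-≤ (f≤g zero) (sum-mono-≤ (f≤g ∘ suc))

sum-nonneg : ∀ {n} {f : Fin n → ℤ} → (∀ i → 0ℤ ≤ f i) → 0ℤ ≤ sum f
sum-nonneg {zero}  0≤f = ℤ.≤-refl
sum-nonneg {suc n} 0≤f = ℤ.+-mono-≤ (0≤f zero) (sum-nonneg (0≤f ∘ suc))

term≤sum : ∀ {n} {f : Fin n → ℤ} → (∀ i → 0ℤ ≤ f i) → ∀ i → f i ≤ sum f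
term≤sum {f = f} 0≤f zero    = ℤ.i≤i+j (f zero) _ {{ℤ.nonNegative (sum-nonneg (0≤f ∘ suc))}}
term≤sum {f = f} 0≤f (suc i) = ℤ.i≤j⇒i≤k+j (f zero) {{ℤ.nonNegative (0≤f zero)}} (term≤sum (0≤f ∘ suc) i)

two-terms≤sum : ∀ {n} {f : Fin n → ℤ} → (∀ i → 0ℤ ≤ f i) →
                ∀ {i j} → i ≢ j → f i + f j ≤ sum f
two-terms≤sum         0≤f {zero}  {zero}  i≢j = ⊥-elim (i≢j refl)
two-terms≤sum {f = f} 0≤f {zero}  {suc j} _   = ℤ.+-monoʳ-≤ (f zero) (term≤sum (0≤f ∘ suc) j)
two-terms≤sum {f = f} 0≤f {suc i} {zero}  _   =
  ℤ.≤-trans (ℤ.≤-reflexive (ℤ.+-comm (f (suc i)) (f zero))) (ℤ.+-monoʳ-≤ (f zero) (term≤sum (0≤f ∘ suc) i))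
two-terms≤sum {f = f} 0≤f {suc i} {suc j} i≢j =
  ℤ.i≤j⇒i≤k+j (f zero) {{ℤ.nonNegative (0≤f zero)}} (two-terms≤sum (0≤f ∘ suc) (i≢j ∘ cong suc))

sum-*ˡ : ∀ {n} x (f : Fin n → ℤ) → sum (λ i → x * f i) ≡ x * sum f
sum-*ˡ {n} x f = sym (*-distribˡ-sum {n} x f)

sum-zero : ∀ {n} {f : Fin n → ℤ} → (∀ i → f i ≡ 0ℤ) → sum f ≡ 0ℤ
sum-zero {n} f≡0 = trans (sum-cong-≗ f≡0) (sum-replicate-zero n)

sum-neg : ∀ {n} (f : Fin n → ℤ) → sum (λ i → - f i) ≡ - sum f
sum-neg f = trans (sum-cong-≗ λ i → sym (ℤ.-1*i≡-i (f i))) (trans (sum-*ˡ -1ℤ f) (ℤ.-1*i≡-i (sum f)))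

sum-difference : ∀ {n} (f g : Fin n → ℤ) → sum (λ i → f i - g i) ≡ sum f - sum g
sum-difference {n} f g = trans (∑-distrib-+ {n} f (λ i → - g i)) (cong (λ s → sum f + s) (sum-neg g))

sum-agree-except : ∀ {n} {f g : Fin n → ℤ} i → (∀ j → j ≢ i → f j ≡ g j) → sum f + g i ≡ sum g + f i
sum-agree-except {suc n} {f} {g} zero f≡g =
  trans (cong (λ s → f zero + s + g zero) (sum-cong-≗ λ j → f≡g (suc j) λ ()))
        (swap (f zero) (g zero) (sum (g ∘ suc)))
  where swap : ∀ x y s → x + s + y ≡ y + s + x
        swap = solve-∀
sum-agree-except {suc n} {f} {g} (suc i) f≡g = begin
  f zero + sum (f ∘ suc) + g (suc i)   ≡⟨ ℤ.+-assoc (f zero) _ _ ⟩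
  f zero + (sum (f ∘ suc) + g (suc i)) ≡⟨ cong₂ _+_ (f≡g zero λ ())
                                                    (sum-agree-except i λ j j≢i → f≡g (suc j) (j≢i ∘ suc-injective)) ⟩
  g zero + (sum (g ∘ suc) + f (suc i)) ≡⟨ ℤ.+-assoc (g zero) _ _ ⟨
  g zero + sum (g ∘ suc) + f (suc i)   ∎
  where open ≡-Reasoning

-- Sums over triples

Σ² : ∀ {n} → (Fin n → Fin n → ℤ) → ℤ
Σ² f = sum λ i → sum λ j → f i j

Σ³ : ∀ {n} → (Fin n → Fin n → Fin n → ℤ) → ℤ
Σ³ F = sum λ i → Σ² (F i)

Σ³-cong : ∀ {n} {F G : Fin n → Fin n → Fin n → ℤ} → (∀ i j k → F i j k ≡ G i j k) → Σ³ F ≡ Σ³ G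
Σ³-cong F≡G = sum-cong-≗ λ i → sum-cong-≗ λ j → sum-cong-≗ λ k → F≡G i j k

Σ³-+ : ∀ {n} (F G : Fin n → Fin n → Fin n → ℤ) → Σ³ (λ i j k → F i j k + G i j k) ≡ Σ³ F + Σ³ G
Σ³-+ {n} F G = trans
  (sum-cong-≗ λ i → trans (sum-cong-≗ λ j → ∑-distrib-+ {n} (F i j) (G i j)) (∑-distrib-+ {n} _ _))
  (∑-distrib-+ {n} _ _)

Σ³-*ˡ : ∀ {n} x (F : Fin n → Fin n → Fin n → ℤ) → Σ³ (λ i j k → x * F i j k) ≡ x * Σ³ F
Σ³-*ˡ {n} x F = sym (trans (*-distribˡ-sum {n} x _) (sum-cong-≗ λ i →
                 trans (*-distribˡ-sum {n} x _) (sum-cong-≗ λ j → *-distribˡ-sum {n} x (F i j))))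

Σ³-rotate : ∀ {n} (F : Fin n → Fin n → Fin n → ℤ) → Σ³ (λ i j k → F j k i) ≡ Σ³ F
Σ³-rotate F = trans (∑-comm λ i j → sum λ k → F j k i) (sum-cong-≗ λ j → ∑-comm λ i k → F j k i)

Σ³-cyclic : ∀ {n} (F : Fin n → Fin n → Fin n → ℤ) →
            Σ³ (λ i j k → F i j k + F j k i + F k i j) ≡ + 3 * Σ³ F
Σ³-cyclic {n} F = begin
  Σ³ (λ i j k → F i j k + F j k i + F k i j)
    ≡⟨ trans (Σ³-+ {n} _ _) (cong (λ s → s + Σ³ (λ i j k → F k i j)) (Σ³-+ {n} _ _)) ⟩
  Σ³ F + Σ³ (λ i j k → F j k i) + Σ³ (λ i j k → F k i j)
    ≡⟨ cong₂ (λ s t → Σ³ F + s + t) (Σ³-rotate F) (sym (Σ³-rotate λ i j k → F k i j)) ⟩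
  Σ³ F + Σ³ F + Σ³ F
    ≡⟨ thrice (Σ³ F) ⟩
  + 3 * Σ³ F ∎
  where
  open ≡-Reasoning
  thrice : ∀ x → x + x + x ≡ + 3 * x
  thrice = solve-∀

Σ³-nonneg-cyclic : ∀ {n} (F : Fin n → Fin n → Fin n → ℤ) →
                   (∀ i j k → 0ℤ ≤ F i j k + F j k i + F k i j) → 0ℤ ≤ Σ³ F
Σ³-nonneg-cyclic F 0≤F = ℤ.*-cancelˡ-≤-pos 0ℤ (Σ³ F) (+ 3)
  (subst (0ℤ ≤_) (Σ³-cyclic F) (sum-nonneg λ i → sum-nonneg λ j → sum-nonneg λ k → 0≤F i j k))

Σ²-suc : ∀ {n} (g : Fin (suc n) → Fin (suc n) → ℤ) →
         Σ² g ≡ g zero zero + sum (λ k → g zero (suc k)) + sum (λ j → g (suc j) zero)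
                + Σ² (λ j k → g (suc j) (suc k))
Σ²-suc {n} g = trans (cong (λ s → sum (g zero) + s) (∑-distrib-+ {n} (λ j → g (suc j) zero) _))
                     (regroup (g zero zero) (sum (λ k → g zero (suc k))) _ _)
  where regroup : ∀ a b c d → a + b + (c + d) ≡ a + b + c + d
        regroup = solve-∀

-- Each triple with three distinct entries lies in a rotation class of size three; peeling off
-- index zero leaves three equal sums over the triples in which it occurs exactly once.
Σ³-divisible-by-3 : ∀ {n} (F : Fin n → Fin n → Fin n → ℤ) → (∀ i j k → F i j k ≡ F j k i) →
                    (∀ i k → F i i k ≡ 0ℤ) → + 3 ∣ Σ³ F
Σ³-divisible-by-3 {zero}  F rot diag = divides 0ℤ refl
Σ³-divisible-by-3 {suc n} F rot diag = subst (+ 3 ∣_) (sym peel)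
  (∣m∣n⇒∣m+n (∣m⇒∣m*n B ∣-refl)
             (Σ³-divisible-by-3 F′ (λ i j k → rot _ _ _) (λ i k → diag _ _)))
  where
  open ≡-Reasoning
  B : ℤ
  B = Σ² (λ j k → F zero (suc j) (suc k))
  F-iji : ∀ i j → F i j i ≡ 0ℤ
  F-iji i j = trans (rot i j i) (trans (rot j i i) (diag i j))
  F-ijj : ∀ i j → F i j j ≡ 0ℤ
  F-ijj i j = trans (rot i j j) (diag j i)
  F′ : Fin n → Fin n → Fin n → ℤ
  F′ i j k = F (suc i) (suc j) (suc k)
  first-block : Σ² (F zero) ≡ B
  first-block = begin
    Σ² (F zero)
      ≡⟨ Σ²-suc (F zero) ⟩
    F zero zero zero + sum (λ k → F zero zero (suc k)) + sum (λ j → F zero (suc j) zero) + B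
      ≡⟨ cong (λ s → s + B) (cong₂ _+_ (cong₂ _+_ (diag zero zero) (sum-zero λ k → diag zero (suc k)))
                                        (sum-zero λ j → F-iji zero (suc j))) ⟩
    0ℤ + B
      ≡⟨ ℤ.+-identityˡ B ⟩
    B ∎
  other-blocks : sum (λ i → Σ² (F (suc i))) ≡ B + B + Σ³ F′
  other-blocks = begin
    sum (λ i → Σ² (F (suc i)))
      ≡⟨ sum-cong-≗ (λ i → Σ²-suc (F (suc i))) ⟩
    sum (λ i → F (suc i) zero zero + sum (λ k → F (suc i) zero (suc k))
               + sum (λ j → F (suc i) (suc j) zero) + Σ² (F′ i))
      ≡⟨ trans (∑-distrib-+ {n} _ _) (cong (λ s → s + Σ³ F′)
           (trans (∑-distrib-+ {n} _ _) (cong (λ s → s + Σ² (λ i j → F (suc i) (suc j) zero))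
             (∑-distrib-+ {n} _ _)))) ⟩
    sum (λ i → F (suc i) zero zero) + Σ² (λ i k → F (suc i) zero (suc k))
    + Σ² (λ i j → F (suc i) (suc j) zero) + Σ³ F′
      ≡⟨ cong (λ s → s + Σ³ F′) (cong₂ _+_
           (cong₂ _+_ (sum-zero λ i → F-ijj (suc i) zero)
                      (trans (sum-cong-≗ λ i → sum-cong-≗ λ k → rot (suc i) zero (suc k))
                             (∑-comm λ i k → F zero (suc k) (suc i))))
           (sum-cong-≗ λ i → sum-cong-≗ λ j → trans (rot (suc i) (suc j) zero) (rot (suc j) zero (suc i)))) ⟩
    0ℤ + B + B + Σ³ F′
      ≡⟨ cong (λ s → s + B + Σ³ F′) (ℤ.+-identityˡ B) ⟩
    B + B + Σ³ F′ ∎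
  peel : Σ³ F ≡ + 3 * B + Σ³ F′
  peel = trans (cong₂ _+_ first-block other-blocks) (regroup B (Σ³ F′))
    where regroup : ∀ b t → b + (b + b + t) ≡ + 3 * b + t
          regroup = solve-∀

-- Entries of a signed adjacency matrix

pos neg unsigned : ℤ → ℤ
pos (+ 1) = 1ℤ
pos _     = 0ℤ
neg -[1+ 0 ] = 1ℤ
neg _        = 0ℤ
unsigned x = + ∣ x ∣

IsEntry : ℤ → Set
IsEntry x = x ≡ + 0 ⊎ x ≡ + 1 ⊎ x ≡ - (+ 1)

entryValue : Fin 3 → ℤ
entryValue zero             = + 0
entryValue (suc zero)       = + 1
entryValue (suc (suc zero)) = - (+ 1)

on-entries : ∀ {P : ℤ → Set} → (∀ u → P (entryValue u)) → ∀ {x} → IsEntry x → P x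
on-entries P[u] (inj₁ refl)        = P[u] zero
on-entries P[u] (inj₂ (inj₁ refl)) = P[u] (suc zero)
on-entries P[u] (inj₂ (inj₂ refl)) = P[u] (suc (suc zero))

decide-entries₁ : ∀ {P : ℤ → Set} (P? : ∀ x → Dec (P x)) →
                  {_ : True (all? λ u → P? (entryValue u))} → ∀ {x} → IsEntry x → P x
decide-entries₁ P? {ok} = on-entries (toWitness ok)

decide-entries₂ : ∀ {P : ℤ → ℤ → Set} (P? : ∀ x y → Dec (P x y)) →
                  {_ : True (all? λ u → all? λ v → P? (entryValue u) (entryValue v))} →
                  ∀ {x y} → IsEntry x → IsEntry y → P x y
decide-entries₂ P? {ok} ex ey = on-entries (λ u → on-entries (toWitness ok u) ey) ex

decide-entries₃ : ∀ {P : ℤ → ℤ → ℤ → Set} (P? : ∀ x y z → Dec (P x y z)) →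
                  {_ : True (all? λ u → all? λ v → all? λ w → P? (entryValue u) (entryValue v) (entryValue w))} →
                  ∀ {x y z} → IsEntry x → IsEntry y → IsEntry z → P x y z
decide-entries₃ P? {ok} ex ey ez =
  on-entries (λ u → on-entries (λ v → on-entries (toWitness ok u v) ez) ey) ex

module _ {n : ℕ} (G : SignedGraph n) where

  private
    σ : Fin n → Fin n → ℤ
    σ = A G

    ∣σ∣ : Fin n → Fin n → ℤ
    ∣σ∣ i j = unsigned (σ i j)

  A²≡sum : ∀ i j → A² G i j ≡ sum (λ k → σ i k * σ k j)
  A²≡sum i j = Σℤ≡sum n _

  Σ³-triangles : ∀ (φ : ℤ → ℤ) →
                 Σ³ (λ i j k → φ (σ i j) * σ j k * σ k i) ≡ Σ² (λ i j → φ (σ i j) * A² G i j)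
  Σ³-triangles φ = sum-cong-≗ λ i → sum-cong-≗ λ j → begin
    sum (λ k → φ (σ i j) * σ j k * σ k i)
      ≡⟨ sum-cong-≗ (λ k → trans (cong₂ (λ y z → φ (σ i j) * y * z) (symm G j k) (symm G k i))
                                  (reorder (φ (σ i j)) (σ k j) (σ i k))) ⟩
    sum (λ k → φ (σ i j) * (σ i k * σ k j))
      ≡⟨ sum-*ˡ {n} (φ (σ i j)) _ ⟩
    φ (σ i j) * sum (λ k → σ i k * σ k j)
      ≡⟨ cong (φ (σ i j) *_) (A²≡sum i j) ⟨
    φ (σ i j) * A² G i j ∎
    where
    open ≡-Reasoning
    reorder : ∀ x y z → x * y * z ≡ x * (z * y)
    reorder = solve-∀

  trace-A³-divisible-by-3 : + 3 ∣ Σ³ (λ i j k → σ i j * σ j k * σ k i)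
  trace-A³-divisible-by-3 =
    Σ³-divisible-by-3 _ (λ i j k → rotate (σ i j) (σ j k) (σ k i))
                        (λ i k → cong (λ x → x * σ i k * σ k i) (loopless G i))
    where rotate : ∀ x y z → x * y * z ≡ y * z * x
          rotate = solve-∀

  commonNeighbours commonNonNeighbours : Fin n → Fin n → ℤ
  commonNeighbours    i j = sum λ k → ∣σ∣ i k * ∣σ∣ k j
  commonNonNeighbours i j = sum λ k → (1ℤ - ∣σ∣ i k) * (1ℤ - ∣σ∣ k j)

  -- A walk i-k-j counts 1 + 1 towards the sum when it is balanced and 1 - 1 when it is not.
  A²+commonNeighbours-even : ∀ i j → + 2 ∣ A² G i j + commonNeighbours i j
  A²+commonNeighbours-even i j = divides (sum λ k → pos (σ i k * σ k j)) (begin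
    A² G i j + commonNeighbours i j
      ≡⟨ cong (λ s → s + commonNeighbours i j) (A²≡sum i j) ⟩
    sum (λ k → σ i k * σ k j) + commonNeighbours i j
      ≡⟨ ∑-distrib-+ {n} _ _ ⟨
    sum (λ k → σ i k * σ k j + ∣σ∣ i k * ∣σ∣ k j)
      ≡⟨ sum-cong-≗ (λ k → decide-entries₂ (λ x y → x * y + unsigned x * unsigned y ≟ pos (x * y) * + 2)
                                            (entry G i k) (entry G k j)) ⟩
    sum (λ k → pos (σ i k * σ k j) * + 2)
      ≡⟨ *-distribʳ-sum {n} (+ 2) _ ⟨
    sum (λ k → pos (σ i k * σ k j)) * + 2 ∎)
    where open ≡-Reasoning

  2≤commonNonNeighbours : ∀ {i j} → i ≢ j → σ i j ≡ 0ℤ → + 2 ≤ commonNonNeighbours i j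
  2≤commonNonNeighbours {i} {j} i≢j σij≡0 =
    ℤ.≤-trans (ℤ.≤-reflexive endpoints)
              (two-terms≤sum {f = λ k → (1ℤ - ∣σ∣ i k) * (1ℤ - ∣σ∣ k j)} nonneg i≢j)
    where
    nonneg : ∀ k → 0ℤ ≤ (1ℤ - ∣σ∣ i k) * (1ℤ - ∣σ∣ k j)
    nonneg k = decide-entries₂ (λ x y → 0ℤ ≤? (1ℤ - unsigned x) * (1ℤ - unsigned y)) (entry G i k) (entry G k j)
    endpoints : + 2 ≡ (1ℤ - ∣σ∣ i i) * (1ℤ - ∣σ∣ i j) + (1ℤ - ∣σ∣ i j) * (1ℤ - ∣σ∣ j j)
    endpoints = at-zeros (loopless G i) σij≡0 (loopless G j)
      where at-zeros : ∀ {x y z} → x ≡ 0ℤ → y ≡ 0ℤ → z ≡ 0ℤ →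
                       + 2 ≡ (1ℤ - unsigned x) * (1ℤ - unsigned y) + (1ℤ - unsigned y) * (1ℤ - unsigned z)
            at-zeros refl refl refl = refl

  unsigned-degree-of-Regular : ∀ {r} → Regular G r → ∀ i → sum (∣σ∣ i) ≡ + r
  unsigned-degree-of-Regular {r} reg i = begin
    sum (∣σ∣ i)          ≡⟨ Σℤ≡sum n _ ⟨
    Σℤ n (∣σ∣ i)         ≡⟨ ℤ.0≤i⇒+∣i∣≡i (subst (0ℤ ≤_) (sym (Σℤ≡sum n _)) nonneg) ⟨
    + ∣ Σℤ n (∣σ∣ i) ∣   ≡⟨ cong +_ (reg i) ⟩
    + r                  ∎
    where
    open ≡-Reasoning
    nonneg : 0ℤ ≤ sum (∣σ∣ i)
    nonneg = sum-nonneg {f = ∣σ∣ i} λ k → ℤ.+≤+ ℕ.z≤n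

  signed-degree-of-NetRegular : ∀ {ρ} → NetRegular G ρ → ∀ i → sum (σ i) ≡ ρ
  signed-degree-of-NetRegular net i = trans (sym (Σℤ≡sum n _)) (net i)

  twice-pos-degree : ∀ {r ρ} → Regular G r → NetRegular G ρ → ∀ i → + 2 * sum (λ k → pos (σ i k)) ≡ + r + ρ
  twice-pos-degree {r} {ρ} reg net i = begin
    + 2 * sum (λ k → pos (σ i k))
      ≡⟨ sum-*ˡ {n} (+ 2) _ ⟨
    sum (λ k → + 2 * pos (σ i k))
      ≡⟨ sum-cong-≗ (λ k → decide-entries₁ (λ x → + 2 * pos x ≟ unsigned x + x) (entry G i k)) ⟩
    sum (λ k → ∣σ∣ i k + σ i k)
      ≡⟨ ∑-distrib-+ {n} _ _ ⟩
    sum (∣σ∣ i) + sum (σ i)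
      ≡⟨ cong₂ _+_ (unsigned-degree-of-Regular reg i) (signed-degree-of-NetRegular net i) ⟩
    + r + ρ ∎
    where open ≡-Reasoning

  twice-neg-degree : ∀ {r ρ} → Regular G r → NetRegular G ρ → ∀ i → + 2 * sum (λ k → neg (σ i k)) ≡ + r - ρ
  twice-neg-degree {r} {ρ} reg net i = begin
    + 2 * sum (λ k → neg (σ i k))
      ≡⟨ sum-*ˡ {n} (+ 2) _ ⟨
    sum (λ k → + 2 * neg (σ i k))
      ≡⟨ sum-cong-≗ (λ k → decide-entries₁ (λ x → + 2 * neg x ≟ unsigned x - x) (entry G i k)) ⟩
    sum (λ k → ∣σ∣ i k - σ i k)
      ≡⟨ sum-difference {n} _ _ ⟩
    sum (∣σ∣ i) - sum (σ i)
      ≡⟨ cong₂ _-_ (unsigned-degree-of-Regular reg i) (signed-degree-of-NetRegular net i) ⟩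
    + r - ρ ∎
    where open ≡-Reasoning

  -- Vertices with p positive and q negative neighbours

  module WithDegrees (p q : ℤ) (pos-degree : ∀ i → sum (λ k → pos (σ i k)) ≡ p)
                                (neg-degree : ∀ i → sum (λ k → neg (σ i k)) ≡ q) where

    unsigned-degree : ∀ i → sum (∣σ∣ i) ≡ p + q
    unsigned-degree i = begin
      sum (∣σ∣ i)
        ≡⟨ sum-cong-≗ (λ k → decide-entries₁ (λ x → unsigned x ≟ pos x + neg x) (entry G i k)) ⟩
      sum (λ k → pos (σ i k) + neg (σ i k))
        ≡⟨ ∑-distrib-+ {n} _ _ ⟩
      sum (λ k → pos (σ i k)) + sum (λ k → neg (σ i k))
        ≡⟨ cong₂ _+_ (pos-degree i) (neg-degree i) ⟩
      p + q ∎
      where open ≡-Reasoning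

    signed-degree : ∀ i → sum (σ i) ≡ p - q
    signed-degree i = begin
      sum (σ i)
        ≡⟨ sum-cong-≗ (λ k → decide-entries₁ (λ x → x ≟ pos x - neg x) (entry G i k)) ⟩
      sum (λ k → pos (σ i k) - neg (σ i k))
        ≡⟨ sum-difference {n} _ _ ⟩
      sum (λ k → pos (σ i k)) - sum (λ k → neg (σ i k))
        ≡⟨ cong₂ _-_ (pos-degree i) (neg-degree i) ⟩
      p - q ∎
      where open ≡-Reasoning

    column-degree : ∀ j → sum (λ k → ∣σ∣ k j) ≡ p + q
    column-degree j = trans (sum-cong-≗ λ k → cong unsigned (symm G k j)) (unsigned-degree j)

    A²-row-sum : ∀ i → sum (A² G i) ≡ (p - q) * (p - q)
    A²-row-sum i = begin
      sum (A² G i)                            ≡⟨ sum-cong-≗ (A²≡sum i) ⟩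
      sum (λ j → sum λ k → σ i k * σ k j)     ≡⟨ ∑-comm (λ j k → σ i k * σ k j) ⟩
      sum (λ k → sum λ j → σ i k * σ k j)     ≡⟨ sum-cong-≗ (λ k → sum-*ˡ (σ i k) (σ k)) ⟩
      sum (λ k → σ i k * sum (σ k))           ≡⟨ sum-cong-≗ (λ k → cong (σ i k *_) (signed-degree k)) ⟩
      sum (λ k → σ i k * (p - q))             ≡⟨ sum-cong-≗ (λ k → ℤ.*-comm (σ i k) (p - q)) ⟩
      sum (λ k → (p - q) * σ i k)             ≡⟨ sum-*ˡ (p - q) (σ i) ⟩
      (p - q) * sum (σ i)                     ≡⟨ cong ((p - q) *_) (signed-degree i) ⟩
      (p - q) * (p - q)                       ∎
      where open ≡-Reasoning

    nonNeighbour-count : ∀ i → sum (λ j → 1ℤ - ∣σ∣ i j) ≡ + n - (p + q)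
    nonNeighbour-count i = begin
      sum (λ j → 1ℤ - ∣σ∣ i j)            ≡⟨ sum-difference {n} _ _ ⟩
      sum {n} (λ _ → 1ℤ) - sum (∣σ∣ i)    ≡⟨ cong₂ _-_ (trans (sum-const n 1ℤ) (ℤ.*-identityʳ (+ n)))
                                                       (unsigned-degree i) ⟩
      + n - (p + q)                       ∎
      where open ≡-Reasoning

    degree<n : Fin n → 1ℤ + (p + q) ≤ + n
    degree<n i = begin
      1ℤ + (p + q)                                 ≡⟨ cong (λ x → 1ℤ - unsigned x + (p + q)) (loopless G i) ⟨
      1ℤ - ∣σ∣ i i + (p + q)                       ≤⟨ ℤ.+-monoˡ-≤ (p + q) (term≤sum nonneg i) ⟩
      sum (λ j → 1ℤ - ∣σ∣ i j) + (p + q)           ≡⟨ cong (λ s → s + (p + q)) (nonNeighbour-count i) ⟩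
      + n - (p + q) + (p + q)                      ≡⟨ cancel (+ n) (p + q) ⟩
      + n                                          ∎
      where
      open ℤ.≤-Reasoning
      nonneg : ∀ j → 0ℤ ≤ 1ℤ - ∣σ∣ i j
      nonneg j = decide-entries₁ (λ x → 0ℤ ≤? 1ℤ - unsigned x) (entry G i j)
      cancel : ∀ m d → m - d + d ≡ m
      cancel = solve-∀

    commonNonNeighbours≡ : ∀ i j →
      commonNonNeighbours i j ≡ + n - (p + q) - (p + q) + commonNeighbours i j
    commonNonNeighbours≡ i j = begin
      commonNonNeighbours i j
        ≡⟨ sum-cong-≗ (λ k → expand (∣σ∣ i k) (∣σ∣ k j)) ⟩
      sum (λ k → 1ℤ - ∣σ∣ i k - ∣σ∣ k j + ∣σ∣ i k * ∣σ∣ k j)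
        ≡⟨ trans (∑-distrib-+ {n} _ _) (cong (λ s → s + commonNeighbours i j) (sum-difference {n} _ _)) ⟩
      sum (λ k → 1ℤ - ∣σ∣ i k) - sum (λ k → ∣σ∣ k j) + commonNeighbours i j
        ≡⟨ cong₂ (λ s t → s - t + commonNeighbours i j) (nonNeighbour-count i) (column-degree j) ⟩
      + n - (p + q) - (p + q) + commonNeighbours i j ∎
      where
      open ≡-Reasoning
      expand : ∀ x y → (1ℤ - x) * (1ℤ - y) ≡ 1ℤ - x - y + x * y
      expand = solve-∀

    commonNeighbours≤degree : ∀ i j → commonNeighbours i j ≤ p + q
    commonNeighbours≤degree i j = ℤ.≤-trans
      (sum-mono-≤ λ k → decide-entries₂ (λ x y → unsigned x * unsigned y ≤? unsigned x) (entry G i k) (entry G k j))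
      (ℤ.≤-reflexive (unsigned-degree i))

    neighbour-of-twin : ∀ {i j} → commonNeighbours i j ≡ p + q →
                        ∀ {l} → ∣σ∣ i l ≡ 1ℤ → ∣σ∣ j l ≡ 1ℤ
    neighbour-of-twin {i} {j} cn≡d {l} il≡1 = trans (cong unsigned (symm G j l))
      (decide-entries₂ (λ x y → (unsigned x * (1ℤ - unsigned y) ≟ 0ℤ) →-dec (unsigned x ≟ 1ℤ) →-dec (unsigned y ≟ 1ℤ))
                       (entry G i l) (entry G l j) term≡0 il≡1)
      where
      nonneg : ∀ l → 0ℤ ≤ ∣σ∣ i l * (1ℤ - ∣σ∣ l j)
      nonneg l = decide-entries₂ (λ x y → 0ℤ ≤? unsigned x * (1ℤ - unsigned y)) (entry G i l) (entry G l j)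
      missed : sum (λ l → ∣σ∣ i l * (1ℤ - ∣σ∣ l j)) ≡ 0ℤ
      missed = begin
        sum (λ l → ∣σ∣ i l * (1ℤ - ∣σ∣ l j))        ≡⟨ sum-cong-≗ (λ l → distrib (∣σ∣ i l) (∣σ∣ l j)) ⟩
        sum (λ l → ∣σ∣ i l - ∣σ∣ i l * ∣σ∣ l j)     ≡⟨ sum-difference {n} _ _ ⟩
        sum (∣σ∣ i) - commonNeighbours i j           ≡⟨ cong₂ _-_ (unsigned-degree i) cn≡d ⟩
        p + q - (p + q)                              ≡⟨ ℤ.+-inverseʳ (p + q) ⟩
        0ℤ                                           ∎
        where
        open ≡-Reasoning
        distrib : ∀ x y → x * (1ℤ - y) ≡ x - x * y
        distrib = solve-∀
      term≡0 : ∣σ∣ i l * (1ℤ - ∣σ∣ l j) ≡ 0ℤ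
      term≡0 = ℤ.≤-antisym (ℤ.≤-trans (term≤sum nonneg l) (ℤ.≤-reflexive missed)) (nonneg l)

    adjacent-commonNeighbours : (∀ {i j} → i ≢ j → σ i j ≡ 0ℤ → commonNeighbours i j ≡ p + q) →
      ∀ {i j} → ∣σ∣ i j ≡ 1ℤ → commonNeighbours i j ≡ (p + q) + (p + q) - + n
    adjacent-commonNeighbours twins {i} {j} ij≡1 = begin
      commonNeighbours i j
        ≡⟨ rearrange (+ n) (p + q) (commonNeighbours i j) ⟩
      (p + q) + (p + q) - + n + (+ n - (p + q) - (p + q) + commonNeighbours i j)
        ≡⟨ cong (λ s → (p + q) + (p + q) - + n + s) (commonNonNeighbours≡ i j) ⟨
      (p + q) + (p + q) - + n + commonNonNeighbours i j
        ≡⟨ cong (λ s → (p + q) + (p + q) - + n + s) (sum-zero λ k → vanishes (covered k)) ⟩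
      (p + q) + (p + q) - + n + 0ℤ
        ≡⟨ ℤ.+-identityʳ _ ⟩
      (p + q) + (p + q) - + n ∎
      where
      open ≡-Reasoning
      rearrange : ∀ m d t → t ≡ d + d - m + (m - d - d + t)
      rearrange = solve-∀
      vanishes : ∀ {x y} → x ≡ 1ℤ ⊎ y ≡ 1ℤ → (1ℤ - x) * (1ℤ - y) ≡ 0ℤ
      vanishes (inj₁ refl) = refl
      vanishes {x} (inj₂ refl) = ℤ.*-zeroʳ (1ℤ - x)
      covered : ∀ k → ∣σ∣ i k ≡ 1ℤ ⊎ ∣σ∣ k j ≡ 1ℤ
      covered k with k Fin.≟ i | entry G i k
      ... | yes refl | _                = inj₂ ij≡1
      ... | no k≢i   | inj₁ ik≡0        = inj₂ (neighbour-of-twin (twins (k≢i ∘ sym) ik≡0) ij≡1)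
      ... | no _     | inj₂ (inj₁ ik≡1) = inj₁ (cong unsigned ik≡1)
      ... | no _     | inj₂ (inj₂ ik≡-1) = inj₁ (cong unsigned ik≡-1)

    column-neg-degree : ∀ i → sum (λ k → neg (σ k i)) ≡ q
    column-neg-degree i = trans (sum-cong-≗ λ k → cong neg (symm G k i)) (neg-degree i)

    -- Among the q negative neighbours k of i, the vertex k = j never has σ j k = 1.
    two-negative-edges-at : ∀ i j →
      sum (λ k → neg (σ i j) * pos (σ j k) * neg (σ k i)) + neg (σ i j) ≤ neg (σ i j) * q
    two-negative-edges-at i j = begin
      sum W + neg (σ i j)
        ≤⟨ ℤ.+-monoʳ-≤ (sum W) (ℤ.≤-trans (ℤ.≤-reflexive (k≡j (loopless G j) (symm G j i)))
                                         (term≤sum R-nonneg j)) ⟩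
      sum W + sum R
        ≡⟨ ∑-distrib-+ {n} W R ⟨
      sum (λ k → W k + R k)
        ≡⟨ sum-cong-≗ (λ k → split (neg (σ i j)) (pos (σ j k)) (neg (σ k i))) ⟩
      sum (λ k → neg (σ i j) * neg (σ k i))
        ≡⟨ sum-*ˡ {n} (neg (σ i j)) _ ⟩
      neg (σ i j) * sum (λ k → neg (σ k i))
        ≡⟨ cong (neg (σ i j) *_) (column-neg-degree i) ⟩
      neg (σ i j) * q ∎
      where
      open ℤ.≤-Reasoning
      W R : Fin n → ℤ
      W k = neg (σ i j) * pos (σ j k) * neg (σ k i)
      R k = neg (σ i j) * (1ℤ - pos (σ j k)) * neg (σ k i)
      R-nonneg : ∀ k → 0ℤ ≤ R k
      R-nonneg k = decide-entries₃ (λ x y z → 0ℤ ≤? neg x * (1ℤ - pos y) * neg z)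
                                   (entry G i j) (entry G j k) (entry G k i)
      k≡j : ∀ {y z} → y ≡ 0ℤ → z ≡ σ i j → neg (σ i j) ≡ neg (σ i j) * (1ℤ - pos y) * neg z
      k≡j refl refl = decide-entries₁ (λ x → neg x ≟ neg x * 1ℤ * neg x) (entry G i j)
      split : ∀ x y z → x * y * z + x * (1ℤ - y) * z ≡ x * z
      split = solve-∀

    Σ³-two-negative-edges : Σ³ (λ i j k → neg (σ i j) * pos (σ j k) * neg (σ k i)) + + n * q ≤ + n * (q * q)
    Σ³-two-negative-edges = begin
      Σ³ W + + n * q
        ≡⟨ cong (λ s → Σ³ W + s) (sum-const n q) ⟨
      Σ³ W + sum {n} (λ _ → q)
        ≡⟨ ∑-distrib-+ {n} _ _ ⟨
      sum (λ i → Σ² (W i) + q)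
        ≤⟨ sum-mono-≤ row ⟩
      sum {n} (λ _ → q * q)
        ≡⟨ sum-const n (q * q) ⟩
      + n * (q * q) ∎
      where
      open ℤ.≤-Reasoning
      W : Fin n → Fin n → Fin n → ℤ
      W i j k = neg (σ i j) * pos (σ j k) * neg (σ k i)
      row : ∀ i → Σ² (W i) + q ≤ q * q
      row i = begin
        Σ² (W i) + q
          ≡⟨ cong (λ s → Σ² (W i) + s) (neg-degree i) ⟨
        Σ² (W i) + sum (λ j → neg (σ i j))
          ≡⟨ ∑-distrib-+ {n} _ _ ⟨
        sum (λ j → sum (W i j) + neg (σ i j))
          ≤⟨ sum-mono-≤ (two-negative-edges-at i) ⟩
        sum (λ j → neg (σ i j) * q)
          ≡⟨ sum-cong-≗ (λ j → ℤ.*-comm (neg (σ i j)) q) ⟩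
        sum (λ j → q * neg (σ i j))
          ≡⟨ sum-*ˡ {n} q _ ⟩
        q * sum (λ j → neg (σ i j))
          ≡⟨ cong (q *_) (neg-degree i) ⟩
        q * q ∎

    -- Strongly regular signed graphs

    module _ {r a b c} (S : IsSRSG G r a b c) where
      open IsSRSG S

      private
        weighted : ∀ {w v : ℤ} x → w ≡ 0ℤ ⊎ (w ≡ 1ℤ × v ≡ x) → w * v ≡ x * w
        weighted x (inj₁ refl)          = sym (ℤ.*-zeroʳ x)
        weighted x (inj₂ (refl , refl)) = ℤ.*-comm 1ℤ x

      pos-A² : ∀ i j → pos (σ i j) * A² G i j ≡ a * pos (σ i j)
      pos-A² i j = weighted a (support (entry G i j))
        where
        support : IsEntry (σ i j) → pos (σ i j) ≡ 0ℤ ⊎ (pos (σ i j) ≡ 1ℤ × A² G i j ≡ a)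
        support (inj₁ e)        = inj₁ (cong pos e)
        support (inj₂ (inj₁ e)) = inj₂ (cong pos e , posAdj i j e)
        support (inj₂ (inj₂ e)) = inj₁ (cong pos e)

      neg-A² : ∀ i j → neg (σ i j) * A² G i j ≡ b * neg (σ i j)
      neg-A² i j = weighted b (support (entry G i j))
        where
        support : IsEntry (σ i j) → neg (σ i j) ≡ 0ℤ ⊎ (neg (σ i j) ≡ 1ℤ × A² G i j ≡ b)
        support (inj₁ e)        = inj₁ (cong neg e)
        support (inj₂ (inj₁ e)) = inj₁ (cong neg e)
        support (inj₂ (inj₂ e)) = inj₂ (cong neg e , negAdj i j e)

      Σ³-positive-first-edge : Σ³ (λ i j k → pos (σ i j) * σ j k * σ k i) ≡ + n * (a * p)
      Σ³-positive-first-edge = trans (Σ³-triangles pos) (trans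
        (sum-cong-≗ λ i → trans (sum-cong-≗ (pos-A² i)) (trans (sum-*ˡ {n} a _) (cong (a *_) (pos-degree i))))
        (sum-const n (a * p)))

      Σ³-negative-first-edge : Σ³ (λ i j k → neg (σ i j) * σ j k * σ k i) ≡ + n * (b * q)
      Σ³-negative-first-edge = trans (Σ³-triangles neg) (trans
        (sum-cong-≗ λ i → trans (sum-cong-≗ (neg-A² i)) (trans (sum-*ˡ {n} b _) (cong (b *_) (neg-degree i))))
        (sum-const n (b * q)))

      Σ³-signed-triangles : Σ³ (λ i j k → σ i j * σ j k * σ k i) ≡ + n * (a * p) - + n * (b * q)
      Σ³-signed-triangles = begin
        Σ³ (λ i j k → σ i j * σ j k * σ k i)
          ≡⟨ Σ³-cong (λ i j k → cong (λ x → x * σ j k * σ k i)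
                                  (decide-entries₁ (λ x → x ≟ pos x - neg x) (entry G i j))) ⟩
        Σ³ (λ i j k → (pos (σ i j) - neg (σ i j)) * σ j k * σ k i)
          ≡⟨ Σ³-cong (λ i j k → split (pos (σ i j)) (neg (σ i j)) (σ j k) (σ k i)) ⟩
        Σ³ (λ i j k → pos (σ i j) * σ j k * σ k i + -1ℤ * (neg (σ i j) * σ j k * σ k i))
          ≡⟨ trans (Σ³-+ {n} _ _)
                   (cong (λ s → Σ³ (λ i j k → pos (σ i j) * σ j k * σ k i) + s) (Σ³-*ˡ {n} -1ℤ _)) ⟩
        Σ³ (λ i j k → pos (σ i j) * σ j k * σ k i) + -1ℤ * Σ³ (λ i j k → neg (σ i j) * σ j k * σ k i)
          ≡⟨ cong₂ (λ s t → s + -1ℤ * t) Σ³-positive-first-edge Σ³-negative-first-edge ⟩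
        + n * (a * p) + -1ℤ * (+ n * (b * q))
          ≡⟨ cong (λ s → + n * (a * p) + s) (ℤ.-1*i≡-i _) ⟩
        + n * (a * p) - + n * (b * q) ∎
        where
        open ≡-Reasoning
        split : ∀ x y s t → (x - y) * s * t ≡ x * s * t + -1ℤ * (y * s * t)
        split = solve-∀

      A²-off-diagonal : ∀ {i j} → i ≢ j → A² G i j ≡ a * pos (σ i j) + b * neg (σ i j) + c * (1ℤ - ∣σ∣ i j)
      A²-off-diagonal {i} {j} i≢j with entry G i j
      ... | inj₁ e =
        subst (λ x → A² G i j ≡ a * pos x + b * neg x + c * (1ℤ - unsigned x)) (sym e)
              (trans (nonAdj i j i≢j e) (only-c a b c))
        where only-c : ∀ a b c → c ≡ a * 0ℤ + b * 0ℤ + c * 1ℤ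
              only-c = solve-∀
      ... | inj₂ (inj₁ e) =
        subst (λ x → A² G i j ≡ a * pos x + b * neg x + c * (1ℤ - unsigned x)) (sym e)
              (trans (posAdj i j e) (only-a a b c))
        where only-a : ∀ a b c → a ≡ a * 1ℤ + b * 0ℤ + c * 0ℤ
              only-a = solve-∀
      ... | inj₂ (inj₂ e) =
        subst (λ x → A² G i j ≡ a * pos x + b * neg x + c * (1ℤ - unsigned x)) (sym e)
              (trans (negAdj i j e) (only-b a b c))
        where only-b : ∀ a b c → b ≡ a * 0ℤ + b * 1ℤ + c * 0ℤ
              only-b = solve-∀

      A²-row-identity : ∀ i → (p - q) * (p - q) + c ≡ a * p + b * q + c * (+ n - (p + q)) + + r
      A²-row-identity i = begin
        (p - q) * (p - q) + c
          ≡⟨ cong₂ _+_ (A²-row-sum i) (sym (on-diagonal (loopless G i))) ⟨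
        sum (A² G i) + off i
          ≡⟨ sum-agree-except i (λ j j≢i → A²-off-diagonal (j≢i ∘ sym)) ⟩
        sum off + A² G i i
          ≡⟨ cong₂ _+_ off-sum (diag i) ⟩
        a * p + b * q + c * (+ n - (p + q)) + + r ∎
        where
        open ≡-Reasoning
        off : Fin n → ℤ
        off j = a * pos (σ i j) + b * neg (σ i j) + c * (1ℤ - ∣σ∣ i j)
        on-diagonal : ∀ {x} → x ≡ 0ℤ → c ≡ a * pos x + b * neg x + c * (1ℤ - unsigned x)
        on-diagonal refl = only-c a b c
          where only-c : ∀ a b c → c ≡ a * 0ℤ + b * 0ℤ + c * 1ℤ
                only-c = solve-∀
        off-sum : sum off ≡ a * p + b * q + c * (+ n - (p + q))
        off-sum = begin
          sum off
            ≡⟨ trans (∑-distrib-+ {n} _ _) (cong (λ s → s + _) (∑-distrib-+ {n} _ _)) ⟩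
          sum (λ j → a * pos (σ i j)) + sum (λ j → b * neg (σ i j)) + sum (λ j → c * (1ℤ - ∣σ∣ i j))
            ≡⟨ cong₂ _+_ (cong₂ _+_ (trans (sum-*ˡ {n} a _) (cong (a *_) (pos-degree i)))
                                     (trans (sum-*ˡ {n} b _) (cong (b *_) (neg-degree i))))
                         (trans (sum-*ˡ {n} c _) (cong (c *_) (nonNeighbour-count i))) ⟩
          a * p + b * q + c * (+ n - (p + q)) ∎

      triangle-inequality : Fin n → 0ℤ ≤ a * p + + 2 * (b * q) + + 3 * (q * (q - 1ℤ))
      triangle-inequality v = ℤ.*-cancelˡ-≤-pos 0ℤ Y (+ 2)
        (ℤ.*-cancelˡ-≤-pos 0ℤ (+ 2 * Y) (+ n) {{n-positive}}
          (subst (_≤ + n * (+ 2 * Y)) (sym (ℤ.*-zeroʳ (+ n)))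
            (subst (0ℤ ≤_) (factor (+ n) (a * p) (b * q) q)
              (ℤ.i≤j⇒0≤j-i 6nq≤))))
        where
        open ℤ.≤-Reasoning
        Y X K : ℤ
        Y = a * p + + 2 * (b * q) + + 3 * (q * (q - 1ℤ))
        X = + 2 * (+ n * (a * p)) + + 4 * (+ n * (b * q))
        K = Σ³ (λ i j k → neg (σ i j) * pos (σ j k) * neg (σ k i))
        n-positive : ℤ.Positive (+ n)
        n-positive = ℤ.positive (ℤ.+<+ (ℕ.>-nonZero⁻¹ n {{nonZeroIndex v}}))
        H : ℤ → ℤ → ℤ → ℤ
        H x y z = + 2 * (pos x * y * z) + + 4 * (neg x * y * z) + + 6 * (neg x * pos y * neg z)
        ΣH≡ : Σ³ (λ i j k → H (σ i j) (σ j k) (σ k i)) ≡ X + + 6 * K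
        ΣH≡ = trans (Σ³-+ {n} _ _) (cong₂ _+_
          (trans (Σ³-+ {n} _ _) (cong₂ _+_ (trans (Σ³-*ˡ {n} (+ 2) _) (cong (+ 2 *_) Σ³-positive-first-edge))
                                           (trans (Σ³-*ˡ {n} (+ 4) _) (cong (+ 4 *_) Σ³-negative-first-edge))))
          (Σ³-*ˡ {n} (+ 6) _))
        0≤X+6K : 0ℤ ≤ X + + 6 * K
        0≤X+6K = subst (0ℤ ≤_) ΣH≡ (Σ³-nonneg-cyclic _ λ i j k →
          decide-entries₃ (λ x y z → 0ℤ ≤? H x y z + H y z x + H z x y) (entry G i j) (entry G j k) (entry G k i))
        6nq≤ : + 6 * (+ n * q) ≤ X + + 6 * (+ n * (q * q))
        6nq≤ = begin
          + 6 * (+ n * q)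
            ≤⟨ ℤ.i≤j⇒i≤k+j (X + + 6 * K) {{ℤ.nonNegative 0≤X+6K}} ℤ.≤-refl ⟩
          X + + 6 * K + + 6 * (+ n * q)
            ≡⟨ regroup X K (+ n * q) ⟩
          X + + 6 * (K + + n * q)
            ≤⟨ ℤ.+-monoʳ-≤ X (ℤ.*-monoˡ-≤-nonNeg (+ 6) Σ³-two-negative-edges) ⟩
          X + + 6 * (+ n * (q * q)) ∎
          where regroup : ∀ x k t → x + + 6 * k + + 6 * t ≡ x + + 6 * (k + t)
                regroup = solve-∀
        factor : ∀ m ap bq q → + 2 * (m * ap) + + 4 * (m * bq) + + 6 * (m * (q * q)) - + 6 * (m * q)
                               ≡ m * (+ 2 * (ap + + 2 * bq + + 3 * (q * (q - 1ℤ))))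
        factor = solve-∀

-- Degree 6 and net degree 2

divisor-pairs-of-4 : ∀ c m → c * + m ≡ + 4 → (m ≡ 1 × c ≡ + 4) ⊎ (m ≡ 2 × c ≡ + 2) ⊎ (m ≡ 4 × c ≡ + 1)
divisor-pairs-of-4 c m cm≡4 = pairs m (ℕ.∣⇒≤ (∣⇒∣ᵤ (divides c (sym cm≡4)))) cm≡4
  where
  pairs : ∀ m → m ℕ.≤ 4 → c * + m ≡ + 4 →
          (m ≡ 1 × c ≡ + 4) ⊎ (m ≡ 2 × c ≡ + 2) ⊎ (m ≡ 4 × c ≡ + 1)
  pairs 0 _ c0≡4 with () ← trans (sym (ℤ.*-zeroʳ c)) c0≡4
  pairs 1 _ c1≡4 = inj₁ (refl , trans (sym (ℤ.*-identityʳ c)) c1≡4)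
  pairs 2 _ c2≡4 = inj₂ (inj₁ (refl , ℤ.*-cancelʳ-≡ c (+ 2) (+ 2) c2≡4))
  pairs 3 _ c3≡4 = ⊥-elim (from-no (+ 3 ∣? + 4) (divides c (sym c3≡4)))
  pairs 4 _ c4≡4 = inj₂ (inj₂ (refl , ℤ.*-cancelʳ-≡ c (+ 1) (+ 4) c4≡4))
  pairs (suc (suc (suc (suc (suc _))))) (ℕ.s≤s (ℕ.s≤s (ℕ.s≤s (ℕ.s≤s ())))) _

seven-plus-divisor-of-4 : ∀ {m} c → 7 ℕ.≤ m → c * (+ m - + 7) ≡ + 4 →
                          m ≡ 8 ⊎ (m ≡ 9 × c ≡ + 2) ⊎ m ≡ 11
seven-plus-divisor-of-4 c (ℕ.s≤s (ℕ.s≤s (ℕ.s≤s (ℕ.s≤s (ℕ.s≤s (ℕ.s≤s (ℕ.s≤s (ℕ.z≤n {k})))))))) eq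
  with divisor-pairs-of-4 c k eq
... | inj₁ (refl , _)           = inj₁ refl
... | inj₂ (inj₁ (refl , c≡2)) = inj₂ (inj₁ (refl , c≡2))
... | inj₂ (inj₂ (refl , _))   = inj₂ (inj₂ refl)

module _ {n : ℕ} (G : SignedGraph n) (reg : Regular G 6) (net : NetRegular G (+ 2)) where

  private
    σ : Fin n → Fin n → ℤ
    σ = A G

    pos-degree : ∀ i → sum (λ k → pos (σ i k)) ≡ + 4
    pos-degree i = ℤ.*-cancelˡ-≡ (+ 2) _ (+ 4) (twice-pos-degree G reg net i)

    neg-degree : ∀ i → sum (λ k → neg (σ i k)) ≡ + 2
    neg-degree i = ℤ.*-cancelˡ-≡ (+ 2) _ (+ 2) (twice-neg-degree G reg net i)

  open WithDegrees G (+ 4) (+ 2) pos-degree neg-degree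

  1≤b-if-a≡-2 : ∀ {b c} → IsSRSG G 6 (- (+ 2)) b c → Fin n → + 1 ≤ b
  1≤b-if-a≡-2 {+ 0}      S v = contradiction (triangle-inequality S v) λ ()
  1≤b-if-a≡-2 {+ suc _}  S v = ℤ.+≤+ (ℕ.s≤s ℕ.z≤n)
  1≤b-if-a≡-2 { -[1+ _ ]} S v = contradiction (triangle-inequality S v) λ ()

  module _ {c} (S : IsSRSG G 6 (- (+ 2)) (+ 1) c) where

    c*[n-7]≡4 : Fin n → c * (+ n - + 7) ≡ + 4
    c*[n-7]≡4 v = begin
      c * (+ n - + 7)                                                         ≡⟨ expand c (+ n) ⟩
      - (+ 2) * + 4 + + 1 * + 2 + c * (+ n - (+ 4 + + 2)) + + 6 - c           ≡⟨ cong (_- c) (A²-row-identity S v) ⟨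
      (+ 4 - + 2) * (+ 4 - + 2) + c - c                                       ≡⟨ cancel c ⟩
      + 4                                                                     ∎
      where
      open ≡-Reasoning
      expand : ∀ c m → c * (m - + 7) ≡ - (+ 2) * + 4 + + 1 * + 2 + c * (m - (+ 4 + + 2)) + + 6 - c
      expand = solve-∀
      cancel : ∀ c → (+ 4 - + 2) * (+ 4 - + 2) + c - c ≡ + 4
      cancel = solve-∀

    3∣trace-A³ : ∀ {m} → n ≡ m → + 3 ∣ + m * (- (+ 2) * + 4) - + m * (+ 1 * + 2)
    3∣trace-A³ refl = subst (+ 3 ∣_) (Σ³-signed-triangles S) (trace-A³-divisible-by-3 G)

    n≢8 : n ≢ 8
    n≢8 n≡8 = from-no (+ 3 ∣? -[1+ 79 ]) (3∣trace-A³ n≡8)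

    n≢11 : n ≢ 11
    n≢11 n≡11 = from-no (+ 3 ∣? -[1+ 109 ]) (3∣trace-A³ n≡11)

    twins-if-n≡9 : n ≡ 9 → c ≡ + 2 → ∀ {i j} → i ≢ j → σ i j ≡ 0ℤ → commonNeighbours G i j ≡ + 4 + + 2
    twins-if-n≡9 n≡9 c≡2 {i} {j} i≢j σij≡0 =
      ℤ.≤-antisym (commonNeighbours≤degree i j) (ℤ.i<j⇒suc[i]≤j (ℤ.≤∧≢⇒< 5≤cn 5≢cn))
      where
      open ℤ.≤-Reasoning
      5≤cn : + 5 ≤ commonNeighbours G i j
      5≤cn = begin
        + 5
          ≤⟨ ℤ.+-monoʳ-≤ (+ 3) (2≤commonNonNeighbours G i≢j σij≡0) ⟩
        + 3 + commonNonNeighbours G i j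
          ≡⟨ cong (λ s → + 3 + s) (commonNonNeighbours≡ i j) ⟩
        + 3 + (+ n - (+ 4 + + 2) - (+ 4 + + 2) + commonNeighbours G i j)
          ≡⟨ cong (λ m → + 3 + (+ m - + 6 - + 6 + commonNeighbours G i j)) n≡9 ⟩
        + 3 + (+ 9 - + 6 - + 6 + commonNeighbours G i j)
          ≡⟨ cancel (commonNeighbours G i j) ⟩
        commonNeighbours G i j ∎
        where cancel : ∀ t → + 3 + (+ 9 - + 6 - + 6 + t) ≡ t
              cancel = solve-∀
      5≢cn : + 5 ≢ commonNeighbours G i j
      5≢cn 5≡cn = from-no (+ 2 ∣? + 7) (subst (+ 2 ∣_)
        (cong₂ _+_ (trans (IsSRSG.nonAdj S i j i≢j σij≡0) c≡2) (sym 5≡cn)) (A²+commonNeighbours-even G i j))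

    no-positive-edge-if-n≡9 : n ≡ 9 → c ≡ + 2 → ∀ {u w} → ¬ PosEdge G u w
    no-positive-edge-if-n≡9 n≡9 c≡2 {u} {w} uw = from-no (+ 2 ∣? + 1)
      (subst (+ 2 ∣_) (cong₂ _+_ (IsSRSG.posAdj S u w uw) cn≡3) (A²+commonNeighbours-even G u w))
      where
      cn≡3 : commonNeighbours G u w ≡ + 3
      cn≡3 = trans (adjacent-commonNeighbours (twins-if-n≡9 n≡9 c≡2) (cong unsigned uw))
                   (cong (λ m → + 4 + + 2 + (+ 4 + + 2) - + m) n≡9)

    no-positive-edge : ∀ {u w} → ¬ PosEdge G u w
    no-positive-edge {u} uw with seven-plus-divisor-of-4 c (ℤ.drop‿+≤+ (degree<n u)) (c*[n-7]≡4 u)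
    ... | inj₁ n≡8               = n≢8 n≡8
    ... | inj₂ (inj₂ n≡11)       = n≢11 n≡11
    ... | inj₂ (inj₁ (n≡9 , c≡2)) = no-positive-edge-if-n≡9 n≡9 c≡2 uw

positive-edge-of-triangle : ∀ {n} (G : SignedGraph n) → UnbalancedTriangleFirstType G →
                            ∃₂ λ u w → PosEdge G u w
positive-edge-of-triangle _ (_ , j , k , _ , _ , _ , inj₁ (_ , jk , _))        = j , k , jk
positive-edge-of-triangle _ (i , j , _ , _ , _ , _ , inj₂ (inj₁ (ij , _ , _))) = i , j , ij
positive-edge-of-triangle _ (i , j , _ , _ , _ , _ , inj₂ (inj₂ (ij , _ , _))) = i , j , ij

lemma3p8 : (n : ℕ) (G : SignedGraph n) (a b c : ℤ) →
    IsSRSG G 6 a b c →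
    (InC₁ G a b c ⊎ InC₄ G a b c ⊎ InC₅ G a b c) →
    Connected G → ¬ Complete G → Regular G 6 → NetRegular G (+ 2) →
    UnbalancedTriangleFirstType G →
    ¬ ((a ≡ - (+ 2) × b ≡ - (+ 1)) ⊎ (a ≡ - (+ 2) × b ≡ + 0) ⊎ (a ≡ - (+ 2) × b ≡ + 1))
lemma3p8 n G a b c S _ _ _ reg net triangle forbidden
  with u , w , uw ← positive-edge-of-triangle G triangle | forbidden
... | inj₁ (refl , refl)        = contradiction (1≤b-if-a≡-2 G reg net S u) λ ()
... | inj₂ (inj₁ (refl , refl)) = contradiction (1≤b-if-a≡-2 G reg net S u) λ { (ℤ.+≤+ ()) }
... | inj₂ (inj₂ (refl , refl)) = no-positive-edge G reg net S uw
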